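{- Let $A=(a_1,\dots,a_k)$ be a real-valued pinwheel instance whose periods take exactly two distinct values (each value may occur any number of times), and suppose $D(A)=\sum_{i=1}^k \frac{1}{a_i}\le \frac{5}{6}$. Then $A$ is schedulable.
   Context: A real-valued pinwheel instance is a finite sequence $A=(a_1,\dots,a_k)$ of real numbers $a_i\ge 1$; $a_i$ is the period of task $i$. A schedule is a map $S:\mathbb{Z}\to\{1,\dots,k\}$. $S$ is valid for $A$ if for every task $i$, every positive integer $l$ and every $m\in\mathbb{Z}$, there are at least $l$ integers $t$ with $m\le t< m+\lceil l a_i\rceil$ and $S(t)=i$. $A$ is schedulable if some schedule is valid for it. The density of $A$ is $D(A)=\sum_{i=1}^k 1/a_i$. -}

module Defs where

open import Level using (0ℓ)
open import Data.Nat as ℕ using (ℕ; zero; suc)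
open import Data.Integer as ℤ using (ℤ)
open import Data.Fin using (Fin; zero; suc)
open import Data.Fin.Properties using () renaming (_≟_ to _≟ᶠ_)
open import Data.Product using (Σ; ∃; ∃-syntax; _×_; _,_)
open import Data.Sum using (_⊎_)
open import Relation.Nullary using (¬_; yes; no)
open import Relation.Binary.PropositionalEquality using (_≡_; _≢_)
import Algebra.Structures as AS

-- The real numbers, axiomatised as a complete ordered field.
-- (Any two models are isomorphic, so quantifying over all models of this
-- record is the same as speaking about ℝ.)

record RealField : Set₁ where
  infixl 6 _+_
  infixl 7 _*_
  infix 4 _≤_
  field
    ℝ   : Set
    0ℝ 1ℝ : ℝ
    _+_ _*_ : ℝ → ℝ → ℝ
    -_  : ℝ → ℝ
    _⁻¹ : ℝ → ℝ          -- multiplicative inverse (value at 0 is irrelevant)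
    _≤_ : ℝ → ℝ → Set
    isCommutativeRing : AS.IsCommutativeRing {A = ℝ} _≡_ _+_ _*_ -_ 0ℝ 1ℝ
    0≢1     : 0ℝ ≢ 1ℝ
    ⁻¹-inverse : ∀ x → x ≢ 0ℝ → x * (x ⁻¹) ≡ 1ℝ
    ≤-refl  : ∀ x → x ≤ x
    ≤-trans : ∀ {x y z} → x ≤ y → y ≤ z → x ≤ z
    ≤-antisym : ∀ {x y} → x ≤ y → y ≤ x → x ≡ y
    ≤-total : ∀ x y → x ≤ y ⊎ y ≤ x
    +-mono-≤ : ∀ {x y} z → x ≤ y → x + z ≤ y + z
    *-nonneg : ∀ {x y} → 0ℝ ≤ x → 0ℝ ≤ y → 0ℝ ≤ x * y
    complete : (P : ℝ → Set) → ∃ P → (∃[ b ] (∀ x → P x → x ≤ b)) →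
               ∃[ s ] ((∀ x → P x → x ≤ s) × (∀ b → (∀ x → P x → x ≤ b) → s ≤ b))

  infix 4 _<_
  _<_ : ℝ → ℝ → Set
  x < y = x ≤ y × x ≢ y

  fromℕ : ℕ → ℝ
  fromℕ zero    = 0ℝ
  fromℕ (suc n) = 1ℝ + fromℕ n

  IsCeil : ℝ → ℕ → Set
  IsCeil x c = x ≤ fromℕ c × fromℕ c + - 1ℝ < x

  sumFin : (k : ℕ) → (Fin k → ℝ) → ℝ
  sumFin zero    f = 0ℝ
  sumFin (suc k) f = f zero + sumFin k (λ i → f (suc i))

  IsInstance : (k : ℕ) → (Fin k → ℝ) → Set
  IsInstance k a = ∀ i → 1ℝ ≤ a i

  density : (k : ℕ) → (Fin k → ℝ) → ℝ
  density k a = sumFin k (λ i → a i ⁻¹)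

  count : {k : ℕ} → (ℤ → Fin k) → Fin k → ℤ → ℕ → ℕ
  count S i m zero = 0
  count S i m (suc n) with S (m ℤ.+ ℤ.+ n) ≟ᶠ i
  ... | yes _ = suc (count S i m n)
  ... | no  _ = count S i m n

  -- S is valid for a: for every task i, positive l and m ∈ ℤ, the window
  -- [m, m + ⌈l·aᵢ⌉) contains at least l slots assigned to i.
  -- (⌈l·aᵢ⌉ ≥ 1 here, so it is a natural number.)
  Valid : (k : ℕ) → (Fin k → ℝ) → (ℤ → Fin k) → Set
  Valid k a S = ∀ (i : Fin k) (l : ℕ) → 1 ℕ.≤ l → (m : ℤ) → (c : ℕ) →
                IsCeil (fromℕ l * a i) c → l ℕ.≤ count S i m c

  Schedulable : (k : ℕ) → (Fin k → ℝ) → Set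
  Schedulable k a = ∃[ S ] Valid k a S

  TwoValued : (k : ℕ) → (Fin k → ℝ) → Set
  TwoValued k a = ∃[ x ] ∃[ y ] (x ≢ y × (∀ i → a i ≡ x ⊎ a i ≡ y)
                                 × (∃[ i ] a i ≡ x) × (∃[ j ] a j ≡ y))

-- Let p tasks have period x and q tasks period y. Scaled by 6, the density bound reads
-- 6p/x + 6q/y ≤ 5, so 6p/x ≤ P and 6q/y ≤ 6 − P for some natural P. Give slot n to the x-tasks
-- when ⌊nP/6⌋ increases at n and to the y-tasks otherwise, serving each group round robin. A
-- window of c ≥ l·x slots contains at least ⌊cP/6⌋ ≥ l·p x-slots, hence l slots of every x-task;
-- symmetrically for the y-tasks. The schedule is periodic, so it extends from ℕ to ℤ.
module Submission where

open import Defs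
open import Level using (0ℓ)
open import Data.Nat using (ℕ)
open import Data.Fin using (Fin)
open import Data.Product using (∃-syntax; _×_; _,_)
open import Data.Sum using (_⊎_; inj₁; inj₂)
open import Function using (_∘_)
open import Relation.Nullary using (¬_; yes; no; contradiction)
open import Relation.Binary.PropositionalEquality
import Relation.Binary.Reasoning.PartialOrder

module RoundRobin where
  open import Data.Nat
  open import Data.Nat.Properties
  open import Data.Nat.DivMod
  open import Data.Nat.Divisibility using (n∣m*n; ∣-refl)
  open import Data.Nat.Tactic.RingSolver using (solve-∀)
  open import Data.Fin using (toℕ)
  open import Data.Fin.Properties using (toℕ<n; toℕ-injective; toℕ-fromℕ<; fromℕ<-cong) renaming (_≟_ to _≟ᶠ_)
  open import Algebra.Properties.CommutativeSemigroup +-commutativeSemigroup using (xy∙z≈xz∙y)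

  occurrences : ∀ {k} → (ℕ → Fin k) → Fin k → ℕ → ℕ
  occurrences F i zero = zero
  occurrences F i (suc c) with F c ≟ᶠ i
  ... | yes _ = suc (occurrences F i c)
  ... | no  _ = occurrences F i c

  occurrences-≤-suc : ∀ {k} (F : ℕ → Fin k) i c → occurrences F i c ≤ occurrences F i (suc c)
  occurrences-≤-suc F i c with F c ≟ᶠ i
  ... | yes _ = n≤1+n _
  ... | no  _ = ≤-refl

  occurrences-suc : ∀ {k} (F : ℕ → Fin k) i c → F c ≡ i →
                    occurrences F i (suc c) ≡ suc (occurrences F i c)
  occurrences-suc F i c Fc≡i with F c ≟ᶠ i
  ... | yes _   = refl
  ... | no Fc≢i = contradiction Fc≡i Fc≢i

  Counter : (ℕ → ℕ) → Set
  Counter g = ∀ n → g (suc n) ≡ g n ⊎ g (suc n) ≡ suc (g n)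

  counter : ∀ {g} → (∀ n → g n ≤ g (suc n)) → (∀ n → g (suc n) ≤ suc (g n)) → Counter g
  counter mono step n with m≤n⇒m<n∨m≡n (mono n)
  ... | inj₁ increases = inj₂ (≤-antisym (step n) increases)
  ... | inj₂ stays     = inj₁ (sym stays)

  counter-∘ : ∀ {f g} → Counter f → Counter g → Counter (f ∘ g)
  counter-∘ {f} {g} f-counts g-counts n with g-counts n
  ... | inj₁ stays = inj₁ (cong f stays)
  ... | inj₂ up    = subst (λ m → f m ≡ f (g n) ⊎ f m ≡ suc (f (g n))) (sym up) (f-counts (g n))

  counter-≤-occurrences : ∀ {k} {F : ℕ → Fin k} {i G} → Counter G →
                          (∀ n → G (suc n) ≡ suc (G n) → F n ≡ i) →
                          ∀ s c → G (s + c) ≤ G s + occurrences (λ n → F (s + n)) i c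
  counter-≤-occurrences {G = G} _ _ s zero rewrite +-identityʳ s = m≤m+n (G s) 0
  counter-≤-occurrences {F = F} {i} {G} counts onlyAt s (suc c) rewrite +-suc s c
    with counts (s + c)
  ... | inj₁ stays = begin
    G (suc (s + c))                ≡⟨ stays ⟩
    G (s + c)                      ≤⟨ counter-≤-occurrences counts onlyAt s c ⟩
    G s + occurrences F′ i c       ≤⟨ +-monoʳ-≤ (G s) (occurrences-≤-suc F′ i c) ⟩
    G s + occurrences F′ i (suc c) ∎
    where
    F′ = λ n → F (s + n)
    open ≤-Reasoning
  ... | inj₂ up = begin
    G (suc (s + c))                ≡⟨ up ⟩
    suc (G (s + c))                ≤⟨ s≤s (counter-≤-occurrences counts onlyAt s c) ⟩
    suc (G s + occurrences F′ i c) ≡⟨ +-suc (G s) _ ⟨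
    G s + suc (occurrences F′ i c) ≡⟨ cong (G s +_) (occurrences-suc F′ i c (onlyAt (s + c) up)) ⟨
    G s + occurrences F′ i (suc c) ∎
    where
    F′ = λ n → F (s + n)
    open ≤-Reasoning

  [1+m]/n≡1+m/n⇒1+m%n≡n : ∀ m n .{{_ : NonZero n}} → suc m / n ≡ suc (m / n) → suc (m % n) ≡ n
  [1+m]/n≡1+m/n⇒1+m%n≡n m n up with m≤n⇒m<n∨m≡n (m%n<n m n)
  ... | inj₂ last = last
  ... | inj₁ 1+m%n<n = contradiction (begin
    suc (m / n)                       ≡⟨ up ⟨
    suc m / n                         ≡⟨ /-congˡ (cong suc (m≡m%n+[m/n]*n m n)) ⟩
    (suc (m % n) + m / n * n) / n     ≡⟨ +-distrib-/-∣ʳ (suc (m % n)) (n∣m*n (m / n)) ⟩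
    suc (m % n) / n + m / n * n / n   ≡⟨ cong₂ _+_ (m<n⇒m/n≡0 1+m%n<n) (m*n/n≡m (m / n) n) ⟩
    m / n                             ∎) 1+n≢n
    where open ≡-Reasoning

  -- The number of z′ < z with z′ % p ≡ toℕ j.
  residueCount : ∀ {p} .{{_ : NonZero p}} → Fin p → ℕ → ℕ
  residueCount {p} j z = (z + (p ∸ suc (toℕ j))) / p

  module _ {p} .{{_ : NonZero p}} (j : Fin p) where
    private
      e = p ∸ suc (toℕ j)

    residueCount-+* : ∀ z l → residueCount j (z + l * p) ≡ residueCount j z + l
    residueCount-+* z l = begin
      (z + l * p + e) / p       ≡⟨ /-congˡ (xy∙z≈xz∙y z (l * p) e) ⟩
      (z + e + l * p) / p       ≡⟨ +-distrib-/-∣ʳ (z + e) (n∣m*n l) ⟩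
      (z + e) / p + l * p / p   ≡⟨ cong ((z + e) / p +_) (m*n/n≡m l p) ⟩
      (z + e) / p + l           ∎
      where open ≡-Reasoning

    residueCount-mono : ∀ {z z′} → z ≤ z′ → residueCount j z ≤ residueCount j z′
    residueCount-mono z≤z′ = /-monoˡ-≤ p (+-monoˡ-≤ e z≤z′)

    residueCount-counter : Counter (residueCount j)
    residueCount-counter = counter (λ z → residueCount-mono (n≤1+n z)) step
      where
      step : ∀ z → residueCount j (suc z) ≤ suc (residueCount j z)
      step z = begin
        suc (z + e) / p           ≤⟨ /-monoˡ-≤ p (+-monoˡ-≤ (z + e) (>-nonZero⁻¹ p)) ⟩
        (p + (z + e)) / p         ≡⟨ +-distrib-/-∣ˡ (z + e) ∣-refl ⟩
        p / p + (z + e) / p       ≡⟨ cong (_+ (z + e) / p) (n/n≡1 p) ⟩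
        suc ((z + e) / p)         ∎
        where open ≤-Reasoning

    residueCount-suc⇒mod : ∀ z → residueCount j (suc z) ≡ suc (residueCount j z) → z mod p ≡ j
    residueCount-suc⇒mod z up = toℕ-injective (trans (toℕ-fromℕ< _) z%p≡j)
      where
      open ≡-Reasoning
      k = (z + e) / p
      z+e%p≡j+e : (z + e) % p ≡ toℕ j + e
      z+e%p≡j+e = suc-injective (trans ([1+m]/n≡1+m/n⇒1+m%n≡n (z + e) p up) (sym (m+[n∸m]≡n (toℕ<n j))))
      z≡j+kp : z ≡ toℕ j + k * p
      z≡j+kp = +-cancelʳ-≡ e z _ (begin
        z + e                  ≡⟨ m≡m%n+[m/n]*n (z + e) p ⟩
        (z + e) % p + k * p    ≡⟨ cong (_+ k * p) z+e%p≡j+e ⟩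
        toℕ j + e + k * p      ≡⟨ xy∙z≈xz∙y (toℕ j) e (k * p) ⟩
        toℕ j + k * p + e      ∎)
      z%p≡j : z % p ≡ toℕ j
      z%p≡j = begin
        z % p                  ≡⟨ cong (_% p) z≡j+kp ⟩
        (toℕ j + k * p) % p    ≡⟨ [m+kn]%n≡m%n (toℕ j) k p ⟩
        toℕ j % p              ≡⟨ m<n⇒m%n≡m (toℕ<n j) ⟩
        toℕ j                  ∎

  round-robin : ∀ {k p} .{{_ : NonZero p}} {F : ℕ → Fin k} {τ : Fin p → Fin k} {g : ℕ → ℕ} →
                Counter g → (∀ n → g (suc n) ≡ suc (g n) → F n ≡ τ (g n mod p)) →
                ∀ j s c l → g s + l * p ≤ g (s + c) → l ≤ occurrences (λ n → F (s + n)) (τ j) c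
  round-robin {p = p} {F} {τ} {g} g-counts serves j s c l grows = +-cancelˡ-≤ (H (g s)) l _ (begin
    H (g s) + l                                         ≡⟨ residueCount-+* j (g s) l ⟨
    H (g s + l * p)                                     ≤⟨ residueCount-mono j grows ⟩
    H (g (s + c))                                       ≤⟨ counter-≤-occurrences H∘g-counts servedAtSteps s c ⟩
    H (g s) + occurrences (λ n → F (s + n)) (τ j) c     ∎)
    where
    open ≤-Reasoning
    H = residueCount j
    H∘g-counts : Counter (H ∘ g)
    H∘g-counts = counter-∘ (residueCount-counter j) g-counts
    servedAtSteps : ∀ n → H (g (suc n)) ≡ suc (H (g n)) → F n ≡ τ j
    servedAtSteps n up with g-counts n
    ... | inj₁ stays = contradiction (trans (sym up) (cong H stays)) 1+n≢n
    ... | inj₂ step  = trans (serves n step)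
                             (cong τ (residueCount-suc⇒mod j (g n) (subst (λ m → H m ≡ suc (H (g n))) step up)))

  -- slotsA n and slotsB n count the slots before n that go to group A and to group B;
  -- group A gets a P/N share of the slots.
  module TwoGroupSchedule {k N} .{{_ : NonZero N}} (P P′ : ℕ) (P+P′≡N : P + P′ ≡ N)
                          {p q} .{{_ : NonZero p}} .{{_ : NonZero q}}
                          (taskA : Fin p → Fin k) (taskB : Fin q → Fin k) where

    slotsA slotsB : ℕ → ℕ
    slotsA n = n * P / N
    slotsB n = n ∸ slotsA n

    serve : ℕ → ℕ → ℕ → Fin k
    serve zero    _ b = taskB (b mod q)
    serve (suc _) a _ = taskA (a mod p)

    schedule : ℕ → Fin k
    schedule n = serve (slotsA (suc n) ∸ slotsA n) (slotsA n) (slotsB n)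

    P≤N : P ≤ N
    P≤N = subst (P ≤_) P+P′≡N (m≤m+n P P′)

    slotsA≤id : ∀ n → slotsA n ≤ n
    slotsA≤id n = begin
      n * P / N   ≤⟨ /-monoˡ-≤ N (*-monoʳ-≤ n P≤N) ⟩
      n * N / N   ≡⟨ m*n/n≡m n N ⟩
      n           ∎
      where open ≤-Reasoning

    slotsA-counter : Counter slotsA
    slotsA-counter = counter (λ n → /-monoˡ-≤ N (*-monoˡ-≤ P (n≤1+n n))) step
      where
      step : ∀ n → slotsA (suc n) ≤ suc (slotsA n)
      step n = begin
        (P + n * P) / N       ≤⟨ /-monoˡ-≤ N (+-monoˡ-≤ (n * P) P≤N) ⟩
        (N + n * P) / N       ≡⟨ +-distrib-/-∣ˡ (n * P) ∣-refl ⟩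
        N / N + slotsA n      ≡⟨ cong (_+ slotsA n) (n/n≡1 N) ⟩
        suc (slotsA n)        ∎
        where open ≤-Reasoning

    slot-owner : ∀ n → (slotsA (suc n) ≡ suc (slotsA n) × slotsB (suc n) ≡ slotsB n)
                     ⊎ (slotsA (suc n) ≡ slotsA n × slotsB (suc n) ≡ suc (slotsB n))
    slot-owner n with slotsA-counter n
    ... | inj₂ up    = inj₁ (up , cong (suc n ∸_) up)
    ... | inj₁ stays = inj₂ (stays , trans (cong (suc n ∸_) stays) (+-∸-assoc 1 (slotsA≤id n)))

    slotsB-counter : Counter slotsB
    slotsB-counter n with slot-owner n
    ... | inj₁ (_ , stays) = inj₁ stays
    ... | inj₂ (_ , up)    = inj₂ up

    schedule-A : ∀ n → slotsA (suc n) ≡ suc (slotsA n) → schedule n ≡ taskA (slotsA n mod p)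
    schedule-A n up =
      cong (λ δ → serve δ (slotsA n) (slotsB n)) (trans (cong (_∸ slotsA n) up) (m+n∸n≡m 1 (slotsA n)))

    schedule-B : ∀ n → slotsB (suc n) ≡ suc (slotsB n) → schedule n ≡ taskB (slotsB n mod q)
    schedule-B n up with slot-owner n
    ... | inj₁ (_ , stays) = contradiction (trans (sym up) stays) 1+n≢n
    ... | inj₂ (stays , _) =
      cong (λ δ → serve δ (slotsA n) (slotsB n)) (trans (cong (_∸ slotsA n) stays) (n∸n≡0 (slotsA n)))

    slotsA-gap : ∀ s c m → m * N ≤ c * P → slotsA s + m ≤ slotsA (s + c)
    slotsA-gap s c m mN≤cP = begin
      s * P / N + m               ≡⟨ cong (s * P / N +_) (m*n/n≡m m N) ⟨
      s * P / N + m * N / N       ≡⟨ +-distrib-/-∣ʳ (s * P) (n∣m*n m) ⟨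
      (s * P + m * N) / N         ≤⟨ /-monoˡ-≤ N (+-monoʳ-≤ (s * P) mN≤cP) ⟩
      (s * P + c * P) / N         ≡⟨ /-congˡ (*-distribʳ-+ P s c) ⟨
      (s + c) * P / N             ∎
      where open ≤-Reasoning

    slotsB-gap : ∀ s c m → m * N ≤ c * P′ → slotsB s + m ≤ slotsB (s + c)
    slotsB-gap s c m mN≤cP′ = +-cancelʳ-≤ (slotsA (s + c)) _ _ (begin
      slotsB s + m + slotsA (s + c)       ≡⟨ +-assoc (slotsB s) m _ ⟩
      slotsB s + (m + slotsA (s + c))     ≤⟨ +-monoʳ-≤ (slotsB s) A-growth ⟩
      slotsB s + (c + slotsA s)           ≡⟨ cong (slotsB s +_) (+-comm c (slotsA s)) ⟩
      slotsB s + (slotsA s + c)           ≡⟨ +-assoc (slotsB s) (slotsA s) c ⟨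
      slotsB s + slotsA s + c             ≡⟨ cong (_+ c) (m∸n+n≡m (slotsA≤id s)) ⟩
      s + c                               ≡⟨ m∸n+n≡m (slotsA≤id (s + c)) ⟨
      slotsB (s + c) + slotsA (s + c)     ∎)
      where
      open ≤-Reasoning
      rearrange : ∀ s c P P′ → c * P′ + (s + c) * P ≡ c * (P + P′) + s * P
      rearrange = solve-∀
      A-growth : m + slotsA (s + c) ≤ c + slotsA s
      A-growth = begin
        m + (s + c) * P / N             ≡⟨ cong (_+ (s + c) * P / N) (m*n/n≡m m N) ⟨
        m * N / N + (s + c) * P / N     ≡⟨ +-distrib-/-∣ˡ ((s + c) * P) (n∣m*n m) ⟨
        (m * N + (s + c) * P) / N       ≤⟨ /-monoˡ-≤ N (+-monoˡ-≤ ((s + c) * P) mN≤cP′) ⟩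
        (c * P′ + (s + c) * P) / N      ≡⟨ /-congˡ (trans (rearrange s c P P′) (cong (λ t → c * t + s * P) P+P′≡N)) ⟩
        (c * N + s * P) / N             ≡⟨ +-distrib-/-∣ˡ (s * P) (n∣m*n c) ⟩
        c * N / N + s * P / N           ≡⟨ cong (_+ slotsA s) (m*n/n≡m c N) ⟩
        c + slotsA s                    ∎

    period : ℕ
    period = p * q * N

    instance
      period-nonZero : NonZero period
      period-nonZero = m*n≢0 (p * q) N {{m*n≢0 p q}}

    slotsA-periodic : ∀ n → slotsA (n + period) ≡ q * P * p + slotsA n
    slotsA-periodic n = begin
      (n + p * q * N) * P / N               ≡⟨ /-congˡ (rearrange n p q N P) ⟩
      (q * P * p * N + n * P) / N           ≡⟨ +-distrib-/-∣ˡ (n * P) (n∣m*n (q * P * p)) ⟩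
      q * P * p * N / N + slotsA n          ≡⟨ cong (_+ slotsA n) (m*n/n≡m (q * P * p) N) ⟩
      q * P * p + slotsA n                  ∎
      where
      open ≡-Reasoning
      rearrange : ∀ n p q N P → (n + p * q * N) * P ≡ q * P * p * N + n * P
      rearrange = solve-∀

    slotsB-periodic : ∀ n → slotsB (n + period) ≡ p * P′ * q + slotsB n
    slotsB-periodic n = begin
      (n + period) ∸ slotsA (n + period)               ≡⟨ cong₂ _∸_ n+period≡ (slotsA-periodic n) ⟩
      (K + (K′ + n)) ∸ (K + slotsA n)                  ≡⟨ [m+n]∸[m+o]≡n∸o K (K′ + n) (slotsA n) ⟩
      (K′ + n) ∸ slotsA n                              ≡⟨ +-∸-assoc K′ (slotsA≤id n) ⟩
      K′ + slotsB n                                    ∎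
      where
      open ≡-Reasoning
      K = q * P * p
      K′ = p * P′ * q
      rearrange : ∀ n p q P P′ → n + p * q * (P + P′) ≡ q * P * p + (p * P′ * q + n)
      rearrange = solve-∀
      n+period≡ : n + period ≡ K + (K′ + n)
      n+period≡ = trans (cong (λ t → n + p * q * t) (sym P+P′≡N)) (rearrange n p q P P′)

    serve-+ : ∀ δ a b u v → serve δ (u * p + a) (v * q + b) ≡ serve δ a b
    serve-+ zero    a b u v = cong taskB (fromℕ<-cong _ _ (%-remove-+ˡ b (n∣m*n v)) _ _)
    serve-+ (suc _) a b u v = cong taskA (fromℕ<-cong _ _ (%-remove-+ˡ a (n∣m*n u)) _ _)

    schedule-periodic : ∀ n → schedule (n + period) ≡ schedule n
    schedule-periodic n = begin
      schedule (n + period)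
        ≡⟨ cong₂ (λ a′ a → serve (a′ ∸ a) a (slotsB (n + period))) (slotsA-periodic (suc n)) (slotsA-periodic n) ⟩
      serve ((K + slotsA (suc n)) ∸ (K + slotsA n)) (K + slotsA n) (slotsB (n + period))
        ≡⟨ cong₂ (λ δ b → serve δ (K + slotsA n) b) ([m+n]∸[m+o]≡n∸o K _ _) (slotsB-periodic n) ⟩
      serve (slotsA (suc n) ∸ slotsA n) (K + slotsA n) (K′ + slotsB n)
        ≡⟨ serve-+ (slotsA (suc n) ∸ slotsA n) (slotsA n) (slotsB n) (q * P) (p * P′) ⟩
      schedule n
        ∎
      where
      open ≡-Reasoning
      K = q * P * p
      K′ = p * P′ * q

    servesA : ∀ j s c l → l * (p * N) ≤ c * P → l ≤ occurrences (λ n → schedule (s + n)) (taskA j) c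
    servesA j s c l lpN≤cP = round-robin slotsA-counter schedule-A j s c l
      (slotsA-gap s c (l * p) (subst (_≤ c * P) (sym (*-assoc l p N)) lpN≤cP))

    servesB : ∀ j s c l → l * (q * N) ≤ c * P′ → l ≤ occurrences (λ n → schedule (s + n)) (taskB j) c
    servesB j s c l lqN≤cP′ = round-robin slotsB-counter schedule-B j s c l
      (slotsB-gap s c (l * q) (subst (_≤ c * P′) (sym (*-assoc l q N)) lqN≤cP′))

module PeriodicExtension where
  open import Data.Nat as ℕ using (ℕ; zero; suc; NonZero)
  import Data.Nat.Properties as ℕ
  open import Algebra.Properties.CommutativeSemigroup ℕ.+-commutativeSemigroup using (x∙yz≈xz∙y)
  open import Data.Integer hiding (NonZero; suc)
  open import Data.Integer.Properties using (pos-+; pos-*; +-injective)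
  open import Data.Integer.DivMod using (a≡a%ℕn+[a/ℕn]*n)
  open import Data.Integer.Tactic.RingSolver using (solve-∀)

  extendℤ : ∀ {A : Set} L .{{_ : NonZero L}} → (ℕ → A) → ℤ → A
  extendℤ L T t = T (t %ℕ L)

  module _ {A : Set} {L} .{{_ : NonZero L}} {T : ℕ → A} (periodic : ∀ n → T (n ℕ.+ L) ≡ T n) where

    periodic-+* : ∀ n e → T (n ℕ.+ e ℕ.* L) ≡ T n
    periodic-+* n zero    = cong T (ℕ.+-identityʳ n)
    periodic-+* n (suc e) = begin
      T (n ℕ.+ (L ℕ.+ e ℕ.* L))   ≡⟨ cong T (x∙yz≈xz∙y n L (e ℕ.* L)) ⟩
      T (n ℕ.+ e ℕ.* L ℕ.+ L)     ≡⟨ periodic (n ℕ.+ e ℕ.* L) ⟩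
      T (n ℕ.+ e ℕ.* L)           ≡⟨ periodic-+* n e ⟩
      T n                         ∎
      where open ≡-Reasoning

    periodic-congruent : ∀ a b d → + a + d * + L ≡ + b → T a ≡ T b
    periodic-congruent a b (+ e) a+eL≡b = begin
      T a                 ≡⟨ periodic-+* a e ⟨
      T (a ℕ.+ e ℕ.* L)   ≡⟨ cong T (+-injective a+eL≡b′) ⟩
      T b                 ∎
      where
      open ≡-Reasoning
      a+eL≡b′ : + (a ℕ.+ e ℕ.* L) ≡ + b
      a+eL≡b′ = trans (pos-+ a (e ℕ.* L)) (trans (cong (λ t → + a + t) (pos-* e L)) a+eL≡b)
    periodic-congruent a b -[1+ e ] a-eL≡b = begin
      T a                       ≡⟨ cong T (+-injective a≡b+eL) ⟩
      T (b ℕ.+ suc e ℕ.* L)     ≡⟨ periodic-+* b (suc e) ⟩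
      T b                       ∎
      where
      open ≡-Reasoning
      cancel : ∀ x d l → x ≡ x + d * l + (- d) * l
      cancel = solve-∀
      a≡b+eL : + a ≡ + (b ℕ.+ suc e ℕ.* L)
      a≡b+eL = begin
        + a                                    ≡⟨ cancel (+ a) -[1+ e ] (+ L) ⟩
        + a + -[1+ e ] * + L + + suc e * + L   ≡⟨ cong (_+ + suc e * + L) a-eL≡b ⟩
        + b + + suc e * + L                    ≡⟨ cong (λ t → + b + t) (pos-* (suc e) L) ⟨
        + b + + (suc e ℕ.* L)                  ≡⟨ pos-+ b (suc e ℕ.* L) ⟨
        + (b ℕ.+ suc e ℕ.* L)                  ∎

    extendℤ-+ : ∀ m n → extendℤ L T (m + + n) ≡ T (m %ℕ L ℕ.+ n)
    extendℤ-+ m n = sym (periodic-congruent (r ℕ.+ n) r′ (w - w′) (begin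
      + (r ℕ.+ n) + (w - w′) * + L         ≡⟨ cong (_+ (w - w′) * + L) (pos-+ r n) ⟩
      + r + + n + (w - w′) * + L           ≡⟨ regroup (+ r) (+ n) w w′ (+ L) ⟩
      + r + w * + L + + n - w′ * + L       ≡⟨ cong (λ t → t + + n - w′ * + L) (a≡a%ℕn+[a/ℕn]*n m L) ⟨
      m + + n - w′ * + L                   ≡⟨ cong (_- w′ * + L) (a≡a%ℕn+[a/ℕn]*n (m + + n) L) ⟩
      + r′ + w′ * + L - w′ * + L           ≡⟨ uncancel (+ r′) w′ (+ L) ⟩
      + r′                                 ∎))
      where
      open ≡-Reasoning
      r = m %ℕ L
      w = m /ℕ L
      r′ = (m + + n) %ℕ L
      w′ = (m + + n) /ℕ L
      regroup : ∀ r n w w′ l → r + n + (w - w′) * l ≡ r + w * l + n - w′ * l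
      regroup = solve-∀
      uncancel : ∀ x w l → x + w * l - w * l ≡ x
      uncancel = solve-∀

module OrderedField (R : RealField) where
  open RealField R
  open import Data.Nat as ℕ using (zero; suc; z≤n; s≤s)
  import Data.Nat.Properties as ℕₚ
  open import Algebra.Bundles using (CommutativeRing)
  open import Relation.Binary.Bundles using (Poset)

  commutativeRing : CommutativeRing 0ℓ 0ℓ
  commutativeRing = record { isCommutativeRing = isCommutativeRing }

  open CommutativeRing commutativeRing public
    using ( +-assoc; +-comm; +-identityˡ; +-identityʳ; -‿inverseʳ
          ; -‿inverseˡ; *-assoc; *-comm; *-identityˡ; *-identityʳ; distribʳ; zeroˡ; zeroʳ )
  open CommutativeRing commutativeRing using (ring; +-commutativeSemigroup; *-commutativeSemigroup)
  open import Algebra.Properties.Ring ring using (-1*x≈-x; -‿involutive)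
  open import Algebra.Properties.CommutativeSemigroup *-commutativeSemigroup public
    using (interchange; xy∙z≈xz∙y)
  open import Algebra.Properties.CommutativeSemigroup +-commutativeSemigroup public
    using () renaming (x∙yz≈y∙xz to x+[y+z]≡y+[x+z])

  ≤-poset : Poset 0ℓ 0ℓ 0ℓ
  ≤-poset = record
    { isPartialOrder = record
      { isPreorder = record
        { isEquivalence = isEquivalence
        ; reflexive     = λ { refl → ≤-refl _ }
        ; trans         = ≤-trans
        }
      ; antisym = ≤-antisym
      }
    }

  module ≤-Reasoning = Relation.Binary.Reasoning.PartialOrder ≤-poset

  +-monoʳ-≤ : ∀ z {x y} → x ≤ y → z + x ≤ z + y
  +-monoʳ-≤ z {x} {y} x≤y = subst₂ _≤_ (+-comm x z) (+-comm y z) (+-mono-≤ z x≤y)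

  x≤x+y : ∀ {x y} → 0ℝ ≤ y → x ≤ x + y
  x≤x+y {x} 0≤y = subst (_≤ x + _) (+-identityʳ x) (+-monoʳ-≤ x 0≤y)

  +-cancelʳ-≤ : ∀ z {x y} → x + z ≤ y + z → x ≤ y
  +-cancelʳ-≤ z {x} {y} x+z≤y+z = subst₂ _≤_ (cancel x) (cancel y) (+-mono-≤ (- z) x+z≤y+z)
    where
    cancel : ∀ t → t + z + - z ≡ t
    cancel t = trans (+-assoc t z (- z)) (trans (cong (t +_) (-‿inverseʳ z)) (+-identityʳ t))

  +-cancelˡ-≤ : ∀ z {x y} → z + x ≤ z + y → x ≤ y
  +-cancelˡ-≤ z {x} {y} z+x≤z+y = +-cancelʳ-≤ z (subst₂ _≤_ (+-comm z x) (+-comm z y) z+x≤z+y)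

  -- If 1 ≤ 0 then 0 ≤ -1, and then 0 ≤ (-1)·(-1) = 1.
  0≤1 : 0ℝ ≤ 1ℝ
  0≤1 with ≤-total 0ℝ 1ℝ
  ... | inj₁ 0≤1 = 0≤1
  ... | inj₂ 1≤0 = subst (0ℝ ≤_) (trans (-1*x≈-x (- 1ℝ)) (-‿involutive 1ℝ)) (*-nonneg 0≤-1 0≤-1)
    where
    0≤-1 : 0ℝ ≤ - 1ℝ
    0≤-1 = subst₂ _≤_ (-‿inverseʳ 1ℝ) (+-identityˡ (- 1ℝ)) (+-mono-≤ (- 1ℝ) 1≤0)

  1≰0 : ¬ (1ℝ ≤ 0ℝ)
  1≰0 1≤0 = 0≢1 (≤-antisym 0≤1 1≤0)

  *-monoʳ-≤ : ∀ {z x y} → 0ℝ ≤ z → x ≤ y → x * z ≤ y * z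
  *-monoʳ-≤ {z} {x} {y} 0≤z x≤y =
    subst₂ _≤_ (+-identityˡ (x * z)) xz+[y-x]z≡yz (+-mono-≤ (x * z) (*-nonneg 0≤y-x 0≤z))
    where
    open ≡-Reasoning
    0≤y-x : 0ℝ ≤ y + - x
    0≤y-x = subst (_≤ y + - x) (-‿inverseʳ x) (+-mono-≤ (- x) x≤y)
    xz+[y-x]z≡yz : (y + - x) * z + x * z ≡ y * z
    xz+[y-x]z≡yz = begin
      (y + - x) * z + x * z     ≡⟨ distribʳ z (y + - x) x ⟨
      (y + - x + x) * z         ≡⟨ cong (_* z) (trans (+-assoc y (- x) x) (cong (y +_) (-‿inverseˡ x))) ⟩
      (y + 0ℝ) * z              ≡⟨ cong (_* z) (+-identityʳ y) ⟩
      y * z                     ∎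

  *-monoˡ-≤ : ∀ {z x y} → 0ℝ ≤ z → x ≤ y → z * x ≤ z * y
  *-monoˡ-≤ {z} {x} {y} 0≤z x≤y = subst₂ _≤_ (*-comm x z) (*-comm y z) (*-monoʳ-≤ 0≤z x≤y)

  fromℕ-+ : ∀ m n → fromℕ (m ℕ.+ n) ≡ fromℕ m + fromℕ n
  fromℕ-+ zero    n = sym (+-identityˡ (fromℕ n))
  fromℕ-+ (suc m) n = trans (cong (1ℝ +_) (fromℕ-+ m n)) (sym (+-assoc 1ℝ (fromℕ m) (fromℕ n)))

  fromℕ-suc-* : ∀ n u → fromℕ (suc n) * u ≡ u + fromℕ n * u
  fromℕ-suc-* n u = trans (distribʳ u 1ℝ (fromℕ n)) (cong (_+ fromℕ n * u) (*-identityˡ u))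

  fromℕ-* : ∀ m n → fromℕ (m ℕ.* n) ≡ fromℕ m * fromℕ n
  fromℕ-* zero    n = sym (zeroˡ (fromℕ n))
  fromℕ-* (suc m) n = begin
    fromℕ (n ℕ.+ m ℕ.* n)         ≡⟨ fromℕ-+ n (m ℕ.* n) ⟩
    fromℕ n + fromℕ (m ℕ.* n)     ≡⟨ cong (fromℕ n +_) (fromℕ-* m n) ⟩
    fromℕ n + fromℕ m * fromℕ n   ≡⟨ fromℕ-suc-* m (fromℕ n) ⟨
    fromℕ (suc m) * fromℕ n       ∎
    where open ≡-Reasoning

  0≤fromℕ : ∀ n → 0ℝ ≤ fromℕ n
  0≤fromℕ zero    = ≤-refl 0ℝ
  0≤fromℕ (suc n) = ≤-trans 0≤1 (x≤x+y (0≤fromℕ n))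

  1≤fromℕ-suc : ∀ n → 1ℝ ≤ fromℕ (suc n)
  1≤fromℕ-suc n = x≤x+y (0≤fromℕ n)

  fromℕ-cancel-≤ : ∀ {m n} → fromℕ m ≤ fromℕ n → m ℕ.≤ n
  fromℕ-cancel-≤ {zero}          _  = z≤n
  fromℕ-cancel-≤ {suc m} {zero}  le = contradiction (≤-trans (1≤fromℕ-suc m) le) 1≰0
  fromℕ-cancel-≤ {suc m} {suc n} le = s≤s (fromℕ-cancel-≤ (+-cancelˡ-≤ 1ℝ le))

  module _ {z} (1≤z : 1ℝ ≤ z) where

    *-inverseʳ : z * z ⁻¹ ≡ 1ℝ
    *-inverseʳ = ⁻¹-inverse z (λ z≡0 → 1≰0 (subst (1ℝ ≤_) z≡0 1≤z))

    ⁻¹-nonneg : 0ℝ ≤ z ⁻¹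
    ⁻¹-nonneg with ≤-total 0ℝ (z ⁻¹)
    ... | inj₁ 0≤z⁻¹ = 0≤z⁻¹
    ... | inj₂ z⁻¹≤0 =
      contradiction (subst₂ _≤_ *-inverseʳ (zeroʳ z) (*-monoˡ-≤ (≤-trans 0≤1 1≤z) z⁻¹≤0)) 1≰0

  between-naturals : ∀ B {α} → 0ℝ ≤ α → α ≤ fromℕ B → ∃[ n ] (fromℕ n ≤ α × α ≤ fromℕ (suc n))
  between-naturals zero    0≤α α≤0   = 0 , 0≤α , ≤-trans α≤0 (0≤fromℕ 1)
  between-naturals (suc B) {α} 0≤α α≤1+B with ≤-total α (fromℕ B)
  ... | inj₁ α≤B = between-naturals B 0≤α α≤B
  ... | inj₂ B≤α = B , B≤α , α≤1+B

  complementary-ceilings : ∀ N′ {α β} → 0ℝ ≤ α → 0ℝ ≤ β → α + β ≤ fromℕ N′ →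
                           ∃[ n ] (n ℕ.≤ N′ × α ≤ fromℕ (suc n) × β ≤ fromℕ (N′ ℕ.∸ n))
  complementary-ceilings N′ {α} {β} 0≤α 0≤β α+β≤N′
    with α≤α+β ← x≤x+y {α} 0≤β
    with between-naturals N′ 0≤α (≤-trans α≤α+β α+β≤N′)
  ... | n , n≤α , α≤1+n = n , n≤N′ , α≤1+n , β≤N′∸n
    where
    n≤N′ : n ℕ.≤ N′
    n≤N′ = fromℕ-cancel-≤ (≤-trans n≤α (≤-trans α≤α+β α+β≤N′))
    β≤N′∸n : β ≤ fromℕ (N′ ℕ.∸ n)
    β≤N′∸n = +-cancelˡ-≤ (fromℕ n) (begin
      fromℕ n + β                   ≤⟨ +-mono-≤ β n≤α ⟩
      α + β                         ≤⟨ α+β≤N′ ⟩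
      fromℕ N′                      ≡⟨ cong fromℕ (ℕₚ.m+[n∸m]≡n n≤N′) ⟨
      fromℕ (n ℕ.+ (N′ ℕ.∸ n))      ≡⟨ fromℕ-+ n (N′ ℕ.∸ n) ⟩
      fromℕ n + fromℕ (N′ ℕ.∸ n)    ∎)
      where open ≤-Reasoning

  share-bound : ∀ {z} l c A P → 1ℝ ≤ z → fromℕ l * z ≤ fromℕ c → fromℕ A * z ⁻¹ ≤ fromℕ P →
                l ℕ.* A ℕ.≤ c ℕ.* P
  share-bound {z} l c A P 1≤z lz≤c Az⁻¹≤P = fromℕ-cancel-≤ (begin
    fromℕ (l ℕ.* A)                    ≡⟨ fromℕ-* l A ⟩
    fromℕ l * fromℕ A                  ≡⟨ regroup ⟨
    fromℕ l * z * (fromℕ A * z ⁻¹)     ≤⟨ *-monoʳ-≤ (*-nonneg (0≤fromℕ A) (⁻¹-nonneg 1≤z)) lz≤c ⟩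
    fromℕ c * (fromℕ A * z ⁻¹)         ≤⟨ *-monoˡ-≤ (0≤fromℕ c) Az⁻¹≤P ⟩
    fromℕ c * fromℕ P                  ≡⟨ fromℕ-* c P ⟨
    fromℕ (c ℕ.* P)                    ∎)
    where
    open ≤-Reasoning
    regroup : fromℕ l * z * (fromℕ A * z ⁻¹) ≡ fromℕ l * fromℕ A
    regroup = trans (interchange (fromℕ l) z (fromℕ A) (z ⁻¹))
                (trans (cong (fromℕ l * fromℕ A *_) (*-inverseʳ 1≤z)) (*-identityʳ _))

module Pinwheel (R : RealField) where
  open RealField R
  open OrderedField R
  open RoundRobin using (occurrences; module TwoGroupSchedule)
  open PeriodicExtension using (extendℤ; extendℤ-+)
  open import Data.Nat as ℕ using (zero; suc; NonZero)
  import Data.Nat.Properties as ℕₚ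
  open import Data.Fin using (zero; suc)
  open import Data.Fin.Properties using (nonZeroIndex) renaming (_≟_ to _≟ᶠ_)
  open import Data.Integer as ℤ using (ℤ; _%ℕ_)
  open import Data.Vec.Functional using (_∷_)
  import Data.Product as Product
  import Data.Sum as Sum

  count≡occurrences : ∀ {k} (S : ℤ → Fin k) m {F : ℕ → Fin k} → (∀ n → S (m ℤ.+ ℤ.+ n) ≡ F n) →
                      ∀ i c → count S i m c ≡ occurrences F i c
  count≡occurrences S m S≗F i zero = refl
  count≡occurrences S m {F} S≗F i (suc c) with S (m ℤ.+ ℤ.+ c) ≟ᶠ i | F c ≟ᶠ i
  ... | yes _    | yes _    = cong suc (count≡occurrences S m S≗F i c)
  ... | no  _    | no  _    = count≡occurrences S m S≗F i c
  ... | yes Sc≡i | no  Fc≢i = contradiction (trans (sym (S≗F c)) Sc≡i) Fc≢i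
  ... | no  Sc≢i | yes Fc≡i = contradiction (trans (S≗F c) Fc≡i) Sc≢i

  record TwoGroups (k : ℕ) (a : Fin k → ℝ) (x y : ℝ) : Set where
    field
      p q        : ℕ
      taskX      : Fin p → Fin k
      taskY      : Fin q → Fin k
      enumerates : ∀ i → (a i ≡ x × ∃[ j ] taskX j ≡ i) ⊎ (a i ≡ y × ∃[ j ] taskY j ≡ i)
      density≡   : density k a ≡ fromℕ p * x ⁻¹ + fromℕ q * y ⁻¹

    p-nonZero : x ≢ y → ∀ {i} → a i ≡ x → NonZero p
    p-nonZero x≢y {i} aᵢ≡x with enumerates i
    ... | inj₁ (_ , j , _) = nonZeroIndex j
    ... | inj₂ (aᵢ≡y , _)  = contradiction (trans (sym aᵢ≡x) aᵢ≡y) x≢y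

    q-nonZero : x ≢ y → ∀ {i} → a i ≡ y → NonZero q
    q-nonZero x≢y {i} aᵢ≡y with enumerates i
    ... | inj₁ (aᵢ≡x , _)  = contradiction (trans (sym aᵢ≡x) aᵢ≡y) x≢y
    ... | inj₂ (_ , j , _) = nonZeroIndex j

  twoGroups : ∀ {x y} k (a : Fin k → ℝ) → (∀ i → a i ≡ x ⊎ a i ≡ y) → TwoGroups k a x y
  twoGroups zero a _ = record
    { p = 0 ; q = 0 ; taskX = λ () ; taskY = λ () ; enumerates = λ ()
    ; density≡ = sym (trans (cong₂ _+_ (zeroˡ _) (zeroˡ _)) (+-identityʳ 0ℝ))
    }
  twoGroups {x} {y} (suc k) a twoValued with twoValued zero
  ... | inj₁ a₀≡x = record
    { p = suc G.p ; q = G.q ; taskX = zero ∷ suc ∘ G.taskX ; taskY = suc ∘ G.taskY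
    ; enumerates = λ
        { zero    → inj₁ (a₀≡x , zero , refl)
        ; (suc i) → Sum.map (Product.map₂ (Product.map suc (cong suc))) (Product.map₂ (Product.map₂ (cong suc)))
                            (G.enumerates i)
        }
    ; density≡ = begin
        a zero ⁻¹ + density k (a ∘ suc)                  ≡⟨ cong₂ _+_ (cong _⁻¹ a₀≡x) G.density≡ ⟩
        x ⁻¹ + (fromℕ G.p * x ⁻¹ + fromℕ G.q * y ⁻¹)    ≡⟨ +-assoc _ _ _ ⟨
        x ⁻¹ + fromℕ G.p * x ⁻¹ + fromℕ G.q * y ⁻¹      ≡⟨ cong (_+ fromℕ G.q * y ⁻¹) (fromℕ-suc-* G.p (x ⁻¹)) ⟨
        fromℕ (suc G.p) * x ⁻¹ + fromℕ G.q * y ⁻¹       ∎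
    }
    where
    open ≡-Reasoning
    module G = TwoGroups (twoGroups k (a ∘ suc) (twoValued ∘ suc))
  ... | inj₂ a₀≡y = record
    { p = G.p ; q = suc G.q ; taskX = suc ∘ G.taskX ; taskY = zero ∷ suc ∘ G.taskY
    ; enumerates = λ
        { zero    → inj₂ (a₀≡y , zero , refl)
        ; (suc i) → Sum.map (Product.map₂ (Product.map₂ (cong suc))) (Product.map₂ (Product.map suc (cong suc)))
                            (G.enumerates i)
        }
    ; density≡ = begin
        a zero ⁻¹ + density k (a ∘ suc)                  ≡⟨ cong₂ _+_ (cong _⁻¹ a₀≡y) G.density≡ ⟩
        y ⁻¹ + (fromℕ G.p * x ⁻¹ + fromℕ G.q * y ⁻¹)    ≡⟨ x+[y+z]≡y+[x+z] _ _ _ ⟩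
        fromℕ G.p * x ⁻¹ + (y ⁻¹ + fromℕ G.q * y ⁻¹)    ≡⟨ cong (fromℕ G.p * x ⁻¹ +_) (fromℕ-suc-* G.q (y ⁻¹)) ⟨
        fromℕ G.p * x ⁻¹ + fromℕ (suc G.q) * y ⁻¹       ∎
    }
    where
    open ≡-Reasoning
    module G = TwoGroups (twoGroups k (a ∘ suc) (twoValued ∘ suc))

  record Shares (N p q : ℕ) (x y : ℝ) : Set where
    field
      P P′   : ℕ
      P+P′≡N : P ℕ.+ P′ ≡ N
      shareX : fromℕ (p ℕ.* N) * x ⁻¹ ≤ fromℕ P
      shareY : fromℕ (q ℕ.* N) * y ⁻¹ ≤ fromℕ P′

  density⇒shares : ∀ {x y} N′ p q → 1ℝ ≤ x → 1ℝ ≤ y →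
           fromℕ p * x ⁻¹ + fromℕ q * y ⁻¹ ≤ fromℕ N′ * fromℕ (suc N′) ⁻¹ → Shares (suc N′) p q x y
  density⇒shares {x} {y} N′ p q 1≤x 1≤y D≤N′/N =
    fromCeilings (complementary-ceilings N′ (nonneg p 1≤x) (nonneg q 1≤y) scaled)
    where
    N = suc N′
    nonneg : ∀ n {z} → 1ℝ ≤ z → 0ℝ ≤ fromℕ (n ℕ.* N) * z ⁻¹
    nonneg n 1≤z = *-nonneg (0≤fromℕ (n ℕ.* N)) (⁻¹-nonneg 1≤z)
    scale : ∀ n u → fromℕ n * u * fromℕ N ≡ fromℕ (n ℕ.* N) * u
    scale n u = trans (xy∙z≈xz∙y (fromℕ n) u (fromℕ N)) (cong (_* u) (sym (fromℕ-* n N)))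
    N′/N*N≡N′ : fromℕ N′ * fromℕ N ⁻¹ * fromℕ N ≡ fromℕ N′
    N′/N*N≡N′ = trans (*-assoc _ _ _)
                  (trans (cong (fromℕ N′ *_) (trans (*-comm _ _) (*-inverseʳ (1≤fromℕ-suc N′)))) (*-identityʳ _))
    scaled : fromℕ (p ℕ.* N) * x ⁻¹ + fromℕ (q ℕ.* N) * y ⁻¹ ≤ fromℕ N′
    scaled = subst₂ _≤_ (trans (distribʳ _ _ _) (cong₂ _+_ (scale p (x ⁻¹)) (scale q (y ⁻¹)))) N′/N*N≡N′
                        (*-monoʳ-≤ (0≤fromℕ N) D≤N′/N)
    fromCeilings : ∃[ n ] (n ℕ.≤ N′ × fromℕ (p ℕ.* N) * x ⁻¹ ≤ fromℕ (suc n)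
                                     × fromℕ (q ℕ.* N) * y ⁻¹ ≤ fromℕ (N′ ℕ.∸ n)) →
                   Shares N p q x y
    fromCeilings (n , n≤N′ , shareX , shareY) = record
      { P = suc n ; P′ = N′ ℕ.∸ n ; P+P′≡N = cong suc (ℕₚ.m+[n∸m]≡n n≤N′) ; shareX = shareX ; shareY = shareY }

  schedulable-by-shares : ∀ {k a x y N} .{{_ : NonZero N}} (G : TwoGroups k a x y) → let open TwoGroups G in
                          .{{_ : NonZero p}} → .{{_ : NonZero q}} →
                          1ℝ ≤ x → 1ℝ ≤ y → Shares N p q x y → Schedulable k a
  schedulable-by-shares {k} {a} {x} {y} {N} G 1≤x 1≤y S = extendℤ period schedule , valid
    where
    open TwoGroups G
    open Shares S
    open TwoGroupSchedule P P′ P+P′≡N taskX taskY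
    valid : Valid k a (extendℤ period schedule)
    valid i l _ m c (l·aᵢ≤c , _) = subst (l ℕ.≤_) (sym count≡) (served (enumerates i))
      where
      s = m %ℕ period
      window : ℕ → Fin k
      window n = schedule (s ℕ.+ n)
      count≡ : count (extendℤ period schedule) i m c ≡ occurrences window i c
      count≡ = count≡occurrences _ m (extendℤ-+ schedule-periodic m) i c
      l·≤c : ∀ {z} → a i ≡ z → fromℕ l * z ≤ fromℕ c
      l·≤c aᵢ≡z = subst (λ z → fromℕ l * z ≤ fromℕ c) aᵢ≡z l·aᵢ≤c
      served : (a i ≡ x × ∃[ j ] taskX j ≡ i) ⊎ (a i ≡ y × ∃[ j ] taskY j ≡ i) → l ℕ.≤ occurrences window i c
      served (inj₁ (aᵢ≡x , j , taskXⱼ≡i)) = subst (λ t → l ℕ.≤ occurrences window t c) taskXⱼ≡i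
        (servesA j s c l (share-bound l c (p ℕ.* N) P 1≤x (l·≤c aᵢ≡x) shareX))
      served (inj₂ (aᵢ≡y , j , taskYⱼ≡i)) = subst (λ t → l ℕ.≤ occurrences window t c) taskYⱼ≡i
        (servesB j s c l (share-bound l c (q ℕ.* N) P′ 1≤y (l·≤c aᵢ≡y) shareY))

theorem6 : (R : RealField) → let open RealField R in
    (k : ℕ) (a : Fin k → ℝ) → IsInstance k a → TwoValued k a →
    density k a ≤ fromℕ 5 * (fromℕ 6 ⁻¹) → Schedulable k a
theorem6 R k a isInstance (x , y , x≢y , twoValued , (i₀ , aᵢ₀≡x) , (i₁ , aᵢ₁≡y)) D≤5/6 =
  schedulable-by-shares G {{p-nonZero x≢y aᵢ₀≡x}} {{q-nonZero x≢y aᵢ₁≡y}} 1≤x 1≤y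
    (density⇒shares 5 p q 1≤x 1≤y (subst (_≤ fromℕ 5 * fromℕ 6 ⁻¹) density≡ D≤5/6))
  where
  open RealField R
  open Pinwheel R
  G : TwoGroups k a x y
  G = twoGroups k a twoValued
  open TwoGroups G
  1≤x : 1ℝ ≤ x
  1≤x = subst (1ℝ ≤_) aᵢ₀≡x (isInstance i₀)
  1≤y : 1ℝ ≤ y
  1≤y = subst (1ℝ ≤_) aᵢ₁≡y (isInstance i₁)
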